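{- For all formulas $\varphi,\psi,\chi\in Fm$ and every variable $x\in V$: $\Vdash(\varphi\equiv\psi)\rightarrow(\chi[x:=\varphi]\equiv\chi[x:=\psi])$, i.e. this formula is satisfied by every interpretation.
   Context: Formulas $Fm$ are generated from an infinite set $V$ of propositional variables by the constant $\bot$, binary connectives $\rightarrow,\vee,\wedge$ and unary $\square$; $\varphi\equiv\psi$ abbreviates $\square(\varphi\rightarrow\psi)\wedge\square(\psi\rightarrow\varphi)$, and $\chi[x:=\varphi]$ is the result of substituting $\varphi$ for $x$ in $\chi$. A Heyting algebra $(M,f_\top,f_\bot,f_\vee,f_\wedge,f_\rightarrow)$ is a bounded lattice with top $f_\top$, bottom $f_\bot$, join $f_\vee$, meet $f_\wedge$, order $\le$, and $f_\rightarrow(m,m')$ the greatest $m''$ with $f_\wedge(m,m'')\le m'$. A filter is a non-empty upward closed $F\subseteq M$ closed under $f_\wedge$ with $f_\bot\notin F$; an ultrafilter is a filter maximal under inclusion. A model $\mathcal{M}=(M,\mathit{TRUE},f_\top,f_\bot,f_\rightarrow,f_\vee,f_\wedge,f_\square)$ is a Heyting algebra with an ultrafilter $\mathit{TRUE}$ and a unary operation $f_\square$ such that for all $m,m',m''\in M$: (1) $f_\square(m)\le m$; (2) $f_\square(f_\rightarrow(m,m'))\le f_\rightarrow(f_\square(f_\rightarrow(m',m'')),f_\square(f_\rightarrow(m,m'')))$; (3) $f_\square(f_\vee(m,m'))\le f_\vee(f_\square(m),f_\square(m'))$; (4) $f_\square(m)\in\mathit{TRUE}\iff m=f_\top$. An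 assignment $\gamma:V\to M$ extends to $Fm$ by $\gamma(\bot)=f_\bot$, $\gamma(\square\varphi)=f_\square(\gamma(\varphi))$, $\gamma(\varphi*\psi)=f_*(\gamma(\varphi),\gamma(\psi))$ for $*\in\{\rightarrow,\vee,\wedge\}$. An interpretation is a pair $(\mathcal{M},\gamma)$; $(\mathcal{M},\gamma)\vDash\varphi$ means $\gamma(\varphi)\in\mathit{TRUE}$; $\Phi\Vdash\varphi$ means every interpretation satisfying all formulas of $\Phi$ satisfies $\varphi$, and $\Vdash\varphi$ means $\emptyset\Vdash\varphi$. -}

module Defs where

open import Level using (Level; suc; _⊔_)
open import Data.Nat using (ℕ; _≟_)
open import Data.Product using (Σ; _×_)
open import Relation.Nullary using (¬_; yes; no)
open import Relation.Binary.PropositionalEquality using (_≡_)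
open import Relation.Binary.Lattice.Structures using (IsHeytingAlgebra)

Var : Set
Var = ℕ

data Fm : Set where
  var  : Var → Fm
  ⊥'   : Fm
  _⇒_  : Fm → Fm → Fm
  _∨'_ : Fm → Fm → Fm
  _∧'_ : Fm → Fm → Fm
  □_   : Fm → Fm

infixr 5 _⇒_
infixr 6 _∨'_
infixr 7 _∧'_
infix 8 □_

_≣_ : Fm → Fm → Fm
φ ≣ ψ = (□ (φ ⇒ ψ)) ∧' (□ (ψ ⇒ φ))

infix 4 _≣_

_[_≔_] : Fm → Var → Fm → Fm
var y    [ x ≔ φ ] with y ≟ x
... | yes _ = φ
... | no  _ = var y
⊥'       [ x ≔ φ ] = ⊥'
(a ⇒ b)  [ x ≔ φ ] = (a [ x ≔ φ ]) ⇒ (b [ x ≔ φ ])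
(a ∨' b) [ x ≔ φ ] = (a [ x ≔ φ ]) ∨' (b [ x ≔ φ ])
(a ∧' b) [ x ≔ φ ] = (a [ x ≔ φ ]) ∧' (b [ x ≔ φ ])
(□ a)    [ x ≔ φ ] = □ (a [ x ≔ φ ])

module _ {ℓ : Level} {M : Set ℓ} (_≤_ : M → M → Set ℓ) (f∧ : M → M → M) (f⊥ : M) where

  record IsFilter (F : M → Set ℓ) : Set ℓ where
    field
      nonEmpty  : Σ M F
      upClosed  : ∀ {m m'} → F m → m ≤ m' → F m'
      ∧-closed  : ∀ {m m'} → F m → F m' → F (f∧ m m')
      ⊥-notIn   : ¬ F f⊥

  record IsUltrafilter (F : M → Set ℓ) : Set (suc ℓ) where
    field
      isFilter : IsFilter F
      maximal  : ∀ (G : M → Set ℓ) → IsFilter G → (∀ {m} → F m → G m) → ∀ {m} → G m → F m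

record Model (ℓ : Level) : Set (suc ℓ) where
  field
    Carrier : Set ℓ
    _≤_     : Carrier → Carrier → Set ℓ
    TRUE    : Carrier → Set ℓ
    f⊤ f⊥   : Carrier
    f⇒ f∨ f∧ : Carrier → Carrier → Carrier
    f□      : Carrier → Carrier
    isHeytingAlgebra : IsHeytingAlgebra _≡_ _≤_ f∨ f∧ f⇒ f⊤ f⊥
    TRUE-ultrafilter : IsUltrafilter _≤_ f∧ f⊥ TRUE
    ax1 : ∀ m → f□ m ≤ m
    ax2 : ∀ m m' m'' → f□ (f⇒ m m') ≤ f⇒ (f□ (f⇒ m' m'')) (f□ (f⇒ m m''))
    ax3 : ∀ m m' → f□ (f∨ m m') ≤ f∨ (f□ m) (f□ m')
    ax4 : ∀ m → (TRUE (f□ m) → m ≡ f⊤) × (m ≡ f⊤ → TRUE (f□ m))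

module _ {ℓ : Level} (𝓜 : Model ℓ) where
  open Model 𝓜

  ⟦_⟧ : Fm → (Var → Carrier) → Carrier
  ⟦ var x ⟧  γ = γ x
  ⟦ ⊥' ⟧     γ = f⊥
  ⟦ a ⇒ b ⟧  γ = f⇒ (⟦ a ⟧ γ) (⟦ b ⟧ γ)
  ⟦ a ∨' b ⟧ γ = f∨ (⟦ a ⟧ γ) (⟦ b ⟧ γ)
  ⟦ a ∧' b ⟧ γ = f∧ (⟦ a ⟧ γ) (⟦ b ⟧ γ)
  ⟦ □ a ⟧    γ = f□ (⟦ a ⟧ γ)

  _⊨_ : (Var → Carrier) → Fm → Set ℓ
  γ ⊨ φ = TRUE (⟦ φ ⟧ γ)

⊩_ : Fm → (ℓ : Level) → Set (suc ℓ)
(⊩ φ) ℓ = (𝓜 : Model ℓ) (γ : Var → Model.Carrier 𝓜) → _⊨_ 𝓜 γ φ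

-- Condition (4) makes □(a → b) true exactly when a → b is the top element, i.e. when
-- a ≤ b; so a true φ ≡ ψ forces φ and ψ to denote the same element, and then so do
-- χ[x:=φ] and χ[x:=ψ], making their ≡ true as well. What remains is that the
-- ultrafilter TRUE satisfies the introduction rule for →: if TRUE a implies TRUE b
-- then TRUE (a → b). This holds because membership in an ultrafilter is stable
-- under double negation: if ¬ a is not in it, adjoining a still gives a proper
-- filter, which by maximality adds nothing.
module Submission where

open import Defs
open import Level using (Level)
open import Data.Nat using (_≟_)
open import Data.Product using (Σ-syntax; _×_; _,_; proj₁; proj₂)
open import Relation.Nullary using (¬_; yes; no)
open import Relation.Binary.PropositionalEquality using (_≡_; refl; cong; cong₂)
open import Relation.Binary.Lattice using (HeytingAlgebra)
import Relation.Binary.Lattice.Properties.HeytingAlgebra as HeytingAlgebraProperties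
import Relation.Binary.Lattice.Properties.MeetSemilattice as MeetSemilatticeProperties

module UltrafilterProperties {ℓ : Level} (H : HeytingAlgebra ℓ ℓ ℓ)
  (F : HeytingAlgebra.Carrier H → Set ℓ)
  (F-ultrafilter : IsUltrafilter (HeytingAlgebra._≤_ H) (HeytingAlgebra._∧_ H) (HeytingAlgebra.⊥ H) F)
  where

  open HeytingAlgebra H renaming (refl to ≤-refl)
  open HeytingAlgebraProperties H using (⇨-eval; y≤x⇨y; ⇨ʳ-covariant)
  open MeetSemilatticeProperties meetSemilattice using (∧-monotonic)
  open IsUltrafilter F-ultrafilter
  open IsFilter isFilter

  F-⊤ : F ⊤
  F-⊤ = upClosed (proj₂ nonEmpty) (maximum _)

  F-consistent : ∀ {x} → F x → ¬ F (x ⇨ ⊥)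
  F-consistent Fx F¬x = ⊥-notIn (upClosed (∧-closed F¬x Fx) ⇨-eval)

  Adjoin : Carrier → Carrier → Set ℓ
  Adjoin a m = Σ[ t ∈ Carrier ] F t × t ∧ a ≤ m

  Adjoin-isFilter : ∀ {a} → ¬ F (a ⇨ ⊥) → IsFilter _≤_ _∧_ ⊥ (Adjoin a)
  Adjoin-isFilter {a} ¬F¬a = record
    { nonEmpty = ⊤ , ⊤ , F-⊤ , maximum _
    ; upClosed = λ { (t , Ft , t∧a≤m) m≤m' → t , Ft , trans t∧a≤m m≤m' }
    ; ∧-closed = λ { (t , Ft , t∧a≤m) (t' , Ft' , t'∧a≤m') →
        t ∧ t' , ∧-closed Ft Ft' ,
        ∧-greatest (trans (∧-monotonic (x∧y≤x t t') ≤-refl) t∧a≤m)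
                   (trans (∧-monotonic (x∧y≤y t t') ≤-refl) t'∧a≤m') }
    ; ⊥-notIn = λ { (t , Ft , t∧a≤⊥) → ¬F¬a (upClosed Ft (transpose-⇨ t∧a≤⊥)) }
    }

  ¬F¬⇒F : ∀ {a} → ¬ F (a ⇨ ⊥) → F a
  ¬F¬⇒F {a} ¬F¬a =
    maximal (Adjoin a) (Adjoin-isFilter ¬F¬a)
      (λ {t} Ft → t , Ft , x∧y≤x t a) (⊤ , F-⊤ , x∧y≤y ⊤ a)

  F-stable : ∀ {a} → ¬ ¬ F a → F a
  F-stable ¬¬Fa = ¬F¬⇒F (λ F¬a → ¬¬Fa (λ Fa → F-consistent Fa F¬a))

  F-⇨-intro : ∀ {a b} → (F a → F b) → F (a ⇨ b)
  F-⇨-intro {a} {b} Fa→Fb = F-stable λ ¬Fa⇨b →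
    let Fa = ¬F¬⇒F (λ F¬a → ¬Fa⇨b (upClosed F¬a (⇨ʳ-covariant (minimum b))))
    in ¬Fa⇨b (upClosed (Fa→Fb Fa) y≤x⇨y)

module ModelProperties {ℓ : Level} (𝓜 : Model ℓ) where

  open Model 𝓜

  heytingAlgebra : HeytingAlgebra ℓ ℓ ℓ
  heytingAlgebra = record { isHeytingAlgebra = isHeytingAlgebra }

  open HeytingAlgebra heytingAlgebra using (antisym; trans; ∧-greatest; x∧y≤x; x∧y≤y; maximum; transpose-∧)
    renaming (refl to ≤-refl)
  open HeytingAlgebraProperties heytingAlgebra using (⇨-unit)
  open UltrafilterProperties heytingAlgebra TRUE TRUE-ultrafilter public using (F-⇨-intro)
  open IsUltrafilter TRUE-ultrafilter using (isFilter)
  open IsFilter isFilter using (upClosed; ∧-closed)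

  ⟦[≔]⟧-cong : ∀ χ x {φ ψ} (γ : Var → Carrier) → ⟦ 𝓜 ⟧ φ γ ≡ ⟦ 𝓜 ⟧ ψ γ →
    ⟦ 𝓜 ⟧ (χ [ x ≔ φ ]) γ ≡ ⟦ 𝓜 ⟧ (χ [ x ≔ ψ ]) γ
  ⟦[≔]⟧-cong (var y) x γ φ≡ψ with y ≟ x
  ... | yes _ = φ≡ψ
  ... | no  _ = refl
  ⟦[≔]⟧-cong ⊥'       x γ φ≡ψ = refl
  ⟦[≔]⟧-cong (a ⇒ b)  x γ φ≡ψ = cong₂ f⇒ (⟦[≔]⟧-cong a x γ φ≡ψ) (⟦[≔]⟧-cong b x γ φ≡ψ)
  ⟦[≔]⟧-cong (a ∨' b) x γ φ≡ψ = cong₂ f∨ (⟦[≔]⟧-cong a x γ φ≡ψ) (⟦[≔]⟧-cong b x γ φ≡ψ)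
  ⟦[≔]⟧-cong (a ∧' b) x γ φ≡ψ = cong₂ f∧ (⟦[≔]⟧-cong a x γ φ≡ψ) (⟦[≔]⟧-cong b x γ φ≡ψ)
  ⟦[≔]⟧-cong (□ a)    x γ φ≡ψ = cong f□ (⟦[≔]⟧-cong a x γ φ≡ψ)

  _≣ᴹ_ : Carrier → Carrier → Carrier
  a ≣ᴹ b = f∧ (f□ (f⇒ a b)) (f□ (f⇒ b a))

  ⇨≡⊤⇒≤ : ∀ {a b} → f⇒ a b ≡ f⊤ → a ≤ b
  ⇨≡⊤⇒≤ {a} refl = trans (∧-greatest (maximum a) ≤-refl) (transpose-∧ ≤-refl)

  TRUE-≣ᴹ⇒≡ : ∀ {a b} → TRUE (a ≣ᴹ b) → a ≡ b
  TRUE-≣ᴹ⇒≡ a≣b = antisym (□-true⇒≤ (upClosed a≣b (x∧y≤x _ _))) (□-true⇒≤ (upClosed a≣b (x∧y≤y _ _)))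
    where
    □-true⇒≤ : ∀ {a b} → TRUE (f□ (f⇒ a b)) → a ≤ b
    □-true⇒≤ □a⇨b = ⇨≡⊤⇒≤ (proj₁ (ax4 _) □a⇨b)

  ≡⇒TRUE-≣ᴹ : ∀ {a b} → a ≡ b → TRUE (a ≣ᴹ b)
  ≡⇒TRUE-≣ᴹ refl = ∧-closed □a⇨a □a⇨a
    where □a⇨a = proj₂ (ax4 _) ⇨-unit

corollary3p7 : ∀ (ℓ : Level) (φ ψ χ : Fm) (x : Var) →
    (⊩ ((φ ≣ ψ) ⇒ ((χ [ x ≔ φ ]) ≣ (χ [ x ≔ ψ ])))) ℓ
corollary3p7 ℓ φ ψ χ x 𝓜 γ =
  F-⇨-intro λ φ≣ψ → ≡⇒TRUE-≣ᴹ (⟦[≔]⟧-cong χ x γ (TRUE-≣ᴹ⇒≡ φ≣ψ))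
  where open ModelProperties 𝓜
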